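{- $f(7) \le 22$.
   Context: A hypergraph $\mathcal{H}$ consists of a vertex set $V(\mathcal{H})$ and a set $E(\mathcal{H})$ of edges, each a nonempty subset of $V(\mathcal{H})$. It is $r$-partite if $V(\mathcal{H})$ can be partitioned into $r$ parts such that every edge contains exactly one vertex from each part. It is intersecting if every two edges share at least one vertex. A cover of $\mathcal{H}$ is a set of vertices meeting every edge, and $\tau(\mathcal{H})$ is the minimum size of a cover. For $r \ge 2$, $f(r)$ denotes the minimum integer such that there exists an $r$-partite intersecting hypergraph $\mathcal{H}$ with $\tau(\mathcal{H}) = r-1$ and with exactly $f(r)$ edges. -}

module Defs where

open import Data.Nat using (ℕ; _≤_; _≥_; _∸_)
open import Data.Fin using (Fin)
open import Data.Fin.Subset using (Subset; _∈_; Nonempty; ∣_∣)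
open import Data.List using (List; length)
open import Data.List.Relation.Unary.All using (All)
open import Data.List.Relation.Unary.Unique.Propositional using (Unique)
open import Data.Product using (Σ; ∃; ∃-syntax; _×_)
open import Relation.Binary.PropositionalEquality using (_≡_)

record Hypergraph (n : ℕ) : Set where
  constructor mkHypergraph
  field
    edges    : List (Subset n)
    nonempty : All Nonempty edges
    distinct : Unique edges
open Hypergraph public

ExactlyOneIn : ∀ {n r} → (Fin n → Fin r) → Subset n → Fin r → Set
ExactlyOneIn p e i = ∃[ v ] (v ∈ e × p v ≡ i × (∀ w → w ∈ e → p w ≡ i → w ≡ v))

IsPartite : ∀ {n} → ℕ → Hypergraph n → Set
IsPartite {n} r H = Σ (Fin n → Fin r) λ p → All (λ e → ∀ i → ExactlyOneIn p e i) (edges H)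

IsIntersecting : ∀ {n} → Hypergraph n → Set
IsIntersecting H = All (λ e → All (λ e' → ∃[ v ] (v ∈ e × v ∈ e')) (edges H)) (edges H)

IsCover : ∀ {n} → Hypergraph n → Subset n → Set
IsCover H C = All (λ e → ∃[ v ] (v ∈ C × v ∈ e)) (edges H)

CoverNumber : ∀ {n} → Hypergraph n → ℕ → Set
CoverNumber H k = (∃[ C ] (IsCover H C × ∣ C ∣ ≡ k)) × (∀ C → IsCover H C → ∣ C ∣ ≥ k)

Realizable : ℕ → ℕ → Set
Realizable r m = ∃[ n ] Σ (Hypergraph n) λ H →
  IsPartite r H × IsIntersecting H × CoverNumber H (r ∸ 1) × length (edges H) ≡ m

module Submission where

-- The hypergraph is "transversal": its vertices are the cells (i , a) of a
-- grid Fin r × Fin s, encoded as Fin (r * s) via 'combine', with part i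
-- consisting of the cells of column i; each edge is the graph
-- { (i , w i) | i < r } of a word w ∈ (Fin s)^r.  For such hypergraphs
--   * every edge meets every part in exactly one cell (partiteness),
--   * two edges meet as soon as their words agree in some position,
--   * every part is a cover, so τ ≤ s,
--   * a cover must contain a cell (i , c i) of the first edge c; removing it
--     leaves a cover, one smaller, of the edges whose words differ from c at
--     position i.  Unfolding this gives a decidable certificate
--     'NoCoverWithin k ws' that forces every cover to have more than k cells.
-- The theorem takes r = 7, s = 6 and 22 words (the zero word and three
-- orbits under cyclic rotation); their distinctness, pairwise agreement, the
-- absence of a 5-cover and the size 6 of a column are checked by evaluation.

open import Defs
open import Data.Nat using (ℕ; zero; suc; _*_; _<_; _≤_; z≤n)
open import Data.Nat.Properties using (≤-refl; ≤-<-trans)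
open import Data.Fin using (Fin; zero; #_; combine; quotient; remainder)
open import Data.Fin.Properties using (all?; any?; remQuot-combine; combine-remQuot) renaming (_≟_ to _≟ᶠ_)
open import Data.Fin.Subset using (Subset; _∈_; _-_; ∣_∣)
open import Data.Fin.Subset.Properties using (x∈p∧x≢y⇒x∈p-y; x∈p⇒∣p-x∣<∣p∣)
open import Data.Vec using (Vec; []; _∷_; lookup; tabulate; last; init; replicate)
open import Data.Vec.Properties using (≡-dec; []=⇒lookup; lookup⇒[]=; lookup∘tabulate; tabulate∘lookup; tabulate-cong)
open import Data.List using (List; []; _∷_; map; filter; iterate; _++_)
open import Data.List.Relation.Unary.All as All using (All; []; _∷_)
open import Data.List.Relation.Unary.All.Properties using (map⁺; map⁻; all-filter; filter⁺)
open import Data.List.Relation.Unary.Unique.Propositional using (Unique)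
import Data.List.Relation.Unary.Unique.Propositional.Properties as Unique
import Data.List.Relation.Unary.Unique.DecPropositional as UniqueDec
open import Data.Product using (∃-syntax; _×_; _,_; proj₁; proj₂)
open import Data.Bool using (true)
open import Data.Empty using (⊥)
open import Data.Unit using (⊤; tt)
open import Relation.Nullary using (Dec; yes; no; does; ¬_; ¬?)
open import Relation.Nullary.Decidable using (toWitness; dec-true)
open import Relation.Binary.PropositionalEquality using (_≡_; refl; sym; trans; cong; subst; module ≡-Reasoning)

subsetOf : ∀ {n} {P : Fin n → Set} → ((v : Fin n) → Dec (P v)) → Subset n
subsetOf P? = tabulate (λ v → does (P? v))

module _ {n : ℕ} {P : Fin n → Set} (P? : (v : Fin n) → Dec (P v)) where

  ∈-subsetOf⁺ : ∀ {v} → P v → v ∈ subsetOf P?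
  ∈-subsetOf⁺ {v} pv = lookup⇒[]= v _ (trans (lookup∘tabulate _ v) (dec-true (P? v) pv))

  ∈-subsetOf⁻ : ∀ {v} → v ∈ subsetOf P? → P v
  ∈-subsetOf⁻ {v} v∈ = witness (P? v) (trans (sym (lookup∘tabulate _ v)) ([]=⇒lookup v∈))
    where
    witness : ∀ {A : Set} (a? : Dec A) → does a? ≡ true → A
    witness (yes a) _ = a

module Transversal (r s : ℕ) where

  open ≡-Reasoning

  Vertex : Set
  Vertex = Fin (r * s)

  column : Vertex → Fin r
  column = quotient s

  row : Vertex → Fin s
  row = remainder {r} s

  cell : Fin r → Fin s → Vertex
  cell = combine

  column-cell : ∀ i a → column (cell i a) ≡ i
  column-cell i a = cong proj₁ (remQuot-combine i a)

  row-cell : ∀ i a → row (cell i a) ≡ a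
  row-cell i a = cong proj₂ (remQuot-combine i a)

  cell-column-row : ∀ v → cell (column v) (row v) ≡ v
  cell-column-row = combine-remQuot {r} s

  Word : Set
  Word = Vec (Fin s) r

  edge : Word → Subset (r * s)
  edge w = subsetOf (λ v → lookup w (column v) ≟ᶠ row v)

  ∈-edge⁻ : ∀ w {v} → v ∈ edge w → lookup w (column v) ≡ row v
  ∈-edge⁻ w = ∈-subsetOf⁻ (λ v → lookup w (column v) ≟ᶠ row v)

  cellOf : Word → Fin r → Vertex
  cellOf w i = cell i (lookup w i)

  cellOf-∈-edge : ∀ w i → cellOf w i ∈ edge w
  cellOf-∈-edge w i = ∈-subsetOf⁺ (λ v → lookup w (column v) ≟ᶠ row v)
    (trans (cong (lookup w) (column-cell i _)) (sym (row-cell i _)))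

  edge-injective : ∀ {w w'} → edge w ≡ edge w' → w ≡ w'
  edge-injective {w} {w'} eq = begin
    w                         ≡⟨ tabulate∘lookup w ⟨
    tabulate (lookup w)       ≡⟨ tabulate-cong agree ⟩
    tabulate (lookup w')      ≡⟨ tabulate∘lookup w' ⟩
    w'                        ∎
    where
    agree : ∀ i → lookup w i ≡ lookup w' i
    agree i = begin
      lookup w i                         ≡⟨ row-cell i _ ⟨
      row (cellOf w i)                   ≡⟨ ∈-edge⁻ w' (subst (cellOf w i ∈_) eq (cellOf-∈-edge w i)) ⟨
      lookup w' (column (cellOf w i))    ≡⟨ cong (lookup w') (column-cell i _) ⟩
      lookup w' i                        ∎

  edge-partite : ∀ w i → ExactlyOneIn column (edge w) i
  edge-partite w i = cellOf w i , cellOf-∈-edge w i , column-cell i _ , unique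
    where
    unique : ∀ v → v ∈ edge w → column v ≡ i → v ≡ cellOf w i
    unique v v∈w refl = begin
      v                                       ≡⟨ cell-column-row v ⟨
      cell (column v) (row v)                 ≡⟨ cong (cell (column v)) (∈-edge⁻ w v∈w) ⟨
      cellOf w (column v)                     ∎

  Agree : Word → Word → Set
  Agree w w' = ∃[ i ] lookup w i ≡ lookup w' i

  agree? : ∀ w w' → Dec (Agree w w')
  agree? w w' = any? (λ i → lookup w i ≟ᶠ lookup w' i)

  agree⇒meet : ∀ {w w'} → Agree w w' → ∃[ v ] (v ∈ edge w × v ∈ edge w')
  agree⇒meet {w} {w'} (i , eq) =
    cellOf w i , cellOf-∈-edge w i , subst (λ a → cell i a ∈ edge w') (sym eq) (cellOf-∈-edge w' i)

  columnSet : Fin r → Subset (r * s)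
  columnSet i = subsetOf (λ v → column v ≟ᶠ i)

  cellOf-∈-columnSet : ∀ w i → cellOf w i ∈ columnSet i
  cellOf-∈-columnSet w i = ∈-subsetOf⁺ (λ v → column v ≟ᶠ i) (column-cell i _)

  Covers : Subset (r * s) → List Word → Set
  Covers C ws = All (λ w → ∃[ v ] (v ∈ C × v ∈ edge w)) ws

  avoiding : Fin r → Fin s → List Word → List Word
  avoiding i a = filter (λ w → ¬? (lookup w i ≟ᶠ a))

  covers-avoiding : ∀ {C v} c ws → v ∈ edge c → Covers C ws →
                    Covers (C - v) (avoiding (column v) (lookup c (column v)) ws)
  covers-avoiding {C} {v} c ws v∈c cov =
    All.map (λ {w} → shrink w) (All.zip (filter⁺ differs? cov , all-filter differs? ws))
    where
    differs? : ∀ w → Dec (¬ lookup w (column v) ≡ lookup c (column v))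
    differs? w = ¬? (lookup w (column v) ≟ᶠ lookup c (column v))

    shrink : ∀ w → (∃[ u ] (u ∈ C × u ∈ edge w)) × ¬ lookup w (column v) ≡ lookup c (column v) →
             ∃[ u ] (u ∈ C - v × u ∈ edge w)
    shrink w ((u , u∈C , u∈w) , differ) = u , x∈p∧x≢y⇒x∈p-y u∈C u≢v , u∈w
      where
      u≢v : ¬ u ≡ v
      u≢v refl = differ (trans (∈-edge⁻ w u∈w) (sym (∈-edge⁻ c v∈c)))

  -- Certificate that no set of at most k cells covers ws, obtained by
  -- branching on which cell of the first edge the cover contains.
  NoCoverWithin : ℕ → List Word → Set
  NoCoverWithin _       []       = ⊥
  NoCoverWithin zero    (_ ∷ _)  = ⊤
  NoCoverWithin (suc k) (c ∷ ws) = ∀ i → NoCoverWithin k (avoiding i (lookup c i) ws)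

  noCoverWithin? : ∀ k ws → Dec (NoCoverWithin k ws)
  noCoverWithin? _       []       = no (λ ())
  noCoverWithin? zero    (_ ∷ _)  = yes tt
  noCoverWithin? (suc k) (c ∷ ws) = all? (λ i → noCoverWithin? k (avoiding i (lookup c i) ws))

  noCoverWithin-sound : ∀ k ws C → NoCoverWithin k ws → Covers C ws → k < ∣ C ∣
  noCoverWithin-sound zero (c ∷ ws) C _ ((v , v∈C , _) ∷ _) =
    ≤-<-trans z≤n (x∈p⇒∣p-x∣<∣p∣ v∈C)
  noCoverWithin-sound (suc k) (c ∷ ws) C none ((v , v∈C , v∈c) ∷ cov) =
    ≤-<-trans (noCoverWithin-sound k _ (C - v) (none (column v)) (covers-avoiding c ws v∈c cov))
              (x∈p⇒∣p-x∣<∣p∣ v∈C)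

  -- The transversal hypergraph of a list of distinct words; its edges are
  -- nonempty as soon as there is at least one column i₀.
  transversal : Fin r → (ws : List Word) → Unique ws → Hypergraph (r * s)
  transversal i₀ ws distinct-ws = mkHypergraph (map edge ws)
    (map⁺ (All.tabulate (λ {w} _ → cellOf w i₀ , cellOf-∈-edge w i₀)))
    (Unique.map⁺ edge-injective distinct-ws)

  module _ (i₀ : Fin r) (ws : List Word) (distinct-ws : Unique ws) where

    private
      H : Hypergraph (r * s)
      H = transversal i₀ ws distinct-ws

    transversal-partite : IsPartite r H
    transversal-partite = column , map⁺ (All.tabulate (λ {w} _ → edge-partite w))

    transversal-intersecting : All (λ w → All (Agree w) ws) ws → IsIntersecting H
    transversal-intersecting agreeing =
      map⁺ (All.map (λ {w} agree-w → map⁺ (All.map (λ {w'} → agree⇒meet {w} {w'}) agree-w)) agreeing)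

    columnSet-covers : ∀ i → IsCover H (columnSet i)
    columnSet-covers i =
      map⁺ (All.tabulate (λ {w} _ → cellOf w i , cellOf-∈-columnSet w i , cellOf-∈-edge w i))

    transversal-coverNumber : ∀ {k} i → ∣ columnSet i ∣ ≡ suc k → NoCoverWithin k ws →
                              CoverNumber H (suc k)
    transversal-coverNumber {k} i size none =
      (columnSet i , columnSet-covers i , size) ,
      (λ C cover → noCoverWithin-sound k ws C none (map⁻ cover))

open Transversal 7 6

rotate : Word → Word
rotate w = last w ∷ init w

orbit : Word → List Word
orbit w = iterate rotate w 7

words : List Word
words = zero-word ∷ orbit (# 1 ∷ # 3 ∷ # 5 ∷ # 5 ∷ # 1 ∷ # 0 ∷ # 3 ∷ [])
                  ++ orbit (# 5 ∷ # 5 ∷ # 2 ∷ # 4 ∷ # 1 ∷ # 5 ∷ # 0 ∷ [])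
                  ++ orbit (# 5 ∷ # 3 ∷ # 3 ∷ # 2 ∷ # 0 ∷ # 2 ∷ # 2 ∷ [])
  where
  zero-word : Word
  zero-word = replicate 7 (# 0)

distinct-words : Unique words
distinct-words = toWitness {a? = UniqueDec.unique? (≡-dec _≟ᶠ_) words} tt

pairwise-agree : All (λ w → All (Agree w) words) words
pairwise-agree = toWitness {a? = All.all? (λ w → All.all? (agree? w) words) words} tt

no-5-cover : NoCoverWithin 5 words
no-5-cover = toWitness {a? = noCoverWithin? 5 words} tt

theorem3 : ∃[ m ] (Realizable 7 m × m ≤ 22)
theorem3 = 22 , (42 , H , transversal-partite zero words distinct-words ,
  transversal-intersecting zero words distinct-words pairwise-agree ,
  transversal-coverNumber zero words distinct-words zero refl no-5-cover , refl) , ≤-refl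
  where
  H : Hypergraph 42
  H = transversal zero words distinct-words
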